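{- Let $\mathbf{s}$ be a Sturmian word of slope $\theta$ with words $V_k$, lengths $t_k$ and formal intercept $(b_k)_{k\ge1}$ as in the context. For $k\ge0$ let $W_k$ be the longest common prefix of $V_{k+1}V_k$ and $V_kV_{k+1}$. Then $W_0=0^{a_1-1-b_1}$ and $W_{k+1}=V_{k+1}^{a_{k+2}-b_{k+2}}W_k$ for $k\ge0$. Consequently the length $w_k$ of $W_k$ is $$w_k=a_1-1-b_1+\sum_{j=1}^k(a_{j+1}-b_{j+1})q_j=q_{k+1}+q_k-t_{k+1}-2,\qquad k\ge0.$$
   Context: $\theta=[0;a_1,a_2,\dots]\in(0,1)$ irrational with $q_{ -1}=0$, $q_0=1$, $q_k=a_kq_{k-1}+q_{k-2}$. Words $M_0=0$, $M_1=0^{a_1-1}1$, $M_k=M_{k-1}^{a_k}M_{k-2}$. A Sturmian word of slope $\theta$ is $s_1s_2\cdots$ or $s'_1s'_2\cdots$ for some $\rho\in[0,1)$, with $s_n=\lfloor n\theta+\rho\rfloor-\lfloor(n-1)\theta+\rho\rfloor$, $s'_n=\lceil n\theta+\rho\rceil-\lceil(n-1)\theta+\rho\rceil$. For $k\ge1$, $V_k$ is the conjugate of $M_k$ (a word $RT$ with $M_k=TR$, $0\le|T|<q_k$) whose first $q_k-1$ letters coincide with those of $\mathbf{s}$, written $V_k=R_kT_k$, $M_k=T_kR_k$, $R_k$ non-empty, $t_k=|T_k|$; $V_{ -1}=1$, $V_0=0$, $t_0=0$. The formal intercept is $b_1=t_1$, $b_{k+1}=(t_{k+1}-t_k)/q_k$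 ($k\ge1$). -}

module Defs where

open import Data.Nat as ℕ using (ℕ; zero; suc; _∸_)
open import Data.Integer as ℤ using (ℤ; +_)
open import Data.Rational.Unnormalised as Q using (ℚᵘ; mkℚᵘ; 0ℚᵘ; 1ℚᵘ)
open import Data.List using (List; []; _∷_; _++_; take; drop; replicate; concat; applyUpTo)
open import Data.Product using (Σ; ∃; _×_)
open import Data.Sum using (_⊎_)
open import Relation.Binary.PropositionalEquality using (_≡_)
open import Relation.Nullary using (yes; no)

ℕ→ℚ : ℕ → ℚᵘ
ℕ→ℚ n = mkℚᵘ (+ n) 0

ℤ→ℚ : ℤ → ℚᵘ
ℤ→ℚ z = mkℚᵘ z 0

-- (m / (d+1)) as a rational
frac : ℤ → ℕ → ℚᵘ
frac m d = mkℚᵘ m d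

inv1+ : ℕ → ℚᵘ
inv1+ k = mkℚᵘ (+ 1) k

-- Real numbers (Bishop): regular Cauchy sequences of rationals,
-- |x_m - x_n| ≤ 1/(m+1) + 1/(n+1).  Then |x_k - x| ≤ 1/(k+1).

record ℝ : Set where
  field
    seq : ℕ → ℚᵘ
    reg : ∀ m n → Q.∣ seq m Q.- seq n ∣ Q.≤ inv1+ m Q.+ inv1+ n
open ℝ public

_<ℝ_ : ℚᵘ → ℝ → Set
r <ℝ x = ∃ λ k → r Q.< seq x k Q.- inv1+ k

_ℝ<_ : ℝ → ℚᵘ → Set
x ℝ< r = ∃ λ k → seq x k Q.+ inv1+ k Q.< r

_≤ℝ_ : ℚᵘ → ℝ → Set
r ≤ℝ x = ∀ k → r Q.≤ seq x k Q.+ inv1+ k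

_ℝ≤_ : ℝ → ℚᵘ → Set
x ℝ≤ r = ∀ k → seq x k Q.- inv1+ k Q.≤ r

-- The real number  n·θ + ρ  compared with rationals.
-- Approximation  n·θ_k + ρ_k  has error at most (n+1)/(k+1).

lin : ℝ → ℝ → ℕ → ℕ → ℚᵘ
lin θ ρ n k = ℕ→ℚ n Q.* seq θ k Q.+ seq ρ k

err : ℕ → ℕ → ℚᵘ
err n k = mkℚᵘ (+ suc n) k

LeLin : ℚᵘ → ℝ → ℝ → ℕ → Set
LeLin r θ ρ n = ∀ k → r Q.≤ lin θ ρ n k Q.+ err n k

LinLt : ℝ → ℝ → ℕ → ℚᵘ → Set
LinLt θ ρ n r = ∃ λ k → lin θ ρ n k Q.+ err n k Q.< r

LtLin : ℚᵘ → ℝ → ℝ → ℕ → Set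
LtLin r θ ρ n = ∃ λ k → r Q.< lin θ ρ n k Q.- err n k

LinLe : ℝ → ℝ → ℕ → ℚᵘ → Set
LinLe θ ρ n r = ∀ k → lin θ ρ n k Q.- err n k Q.≤ r

IsFloor : ℝ → ℝ → ℕ → ℤ → Set
IsFloor θ ρ n m = LeLin (ℤ→ℚ m) θ ρ n × LinLt θ ρ n (ℤ→ℚ (m ℤ.+ + 1))

IsCeil : ℝ → ℝ → ℕ → ℤ → Set
IsCeil θ ρ n m = LtLin (ℤ→ℚ (m ℤ.- + 1)) θ ρ n × LinLe θ ρ n (ℤ→ℚ m)

-- Continued fraction data.  a : ℕ → ℕ, a k = a_k for k ≥ 1 (a 0 unused).

-- q k = q_k for k ≥ 0   (q_{-1} = 0, q_0 = 1, so q_1 = a_1)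
q : (ℕ → ℕ) → ℕ → ℕ
q a zero = 1
q a (suc zero) = a 1
q a (suc (suc k)) = a (suc (suc k)) ℕ.* q a (suc k) ℕ.+ q a k

-- p k = p_k for k ≥ 0   (p_{-1} = 1, p_0 = 0, so p_1 = 1)
p : (ℕ → ℕ) → ℕ → ℕ
p a zero = 0
p a (suc zero) = 1
p a (suc (suc k)) = a (suc (suc k)) ℕ.* p a (suc k) ℕ.+ p a k

-- the convergent p_k / q_k   (q_k ≥ 1 when all a_k ≥ 1)
conv : (ℕ → ℕ) → ℕ → ℚᵘ
conv a k = frac (+ p a k) (q a k ∸ 1)

-- θ = [0; a_1, a_2, ...]: θ lies strictly between p_{2j}/q_{2j} and
-- p_{2j+1}/q_{2j+1} for every j (the convergents converge to θ).
HasCF : ℝ → (ℕ → ℕ) → Set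
HasCF θ a = ∀ j → (conv a (2 ℕ.* j) <ℝ θ) × (θ ℝ< conv a (suc (2 ℕ.* j)))

-- Sturmian words.  An infinite word is  s : ℕ → ℕ  with  s i = s_{i+1}.

InUnit : ℝ → Set
InUnit ρ = (0ℚᵘ ≤ℝ ρ) × (ρ ℝ< 1ℚᵘ)

LowerMech : ℝ → ℝ → (ℕ → ℕ) → Set
LowerMech θ ρ s = Σ (ℕ → ℤ) λ F →
  (∀ n → IsFloor θ ρ n (F n)) × (∀ n → + s n ≡ F (suc n) ℤ.- F n)

UpperMech : ℝ → ℝ → (ℕ → ℕ) → Set
UpperMech θ ρ s = Σ (ℕ → ℤ) λ F →
  (∀ n → IsCeil θ ρ n (F n)) × (∀ n → + s n ≡ F (suc n) ℤ.- F n)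

Sturmian : ℝ → (ℕ → ℕ) → Set
Sturmian θ s = Σ ℝ λ ρ → InUnit ρ × (LowerMech θ ρ s ⊎ UpperMech θ ρ s)

Word : Set
Word = List ℕ

_^^_ : Word → ℕ → Word
w ^^ e = concat (replicate e w)

-- M_k,  k ≥ 0   (M_{-1} = 1)
M : (ℕ → ℕ) → ℕ → Word
M a zero = 0 ∷ []
M a (suc zero) = replicate (a 1 ∸ 1) 0 ++ (1 ∷ [])
M a (suc (suc k)) = (M a (suc k) ^^ a (suc (suc k))) ++ M a k

rot : ℕ → Word → Word
rot t w = drop t w ++ take t w

pref : (ℕ → ℕ) → ℕ → Word
pref s n = applyUpTo s n

-- t : ℕ → ℕ (t k = t_k) describes the words V_k:  t_0 = 0 and for k ≥ 1,
-- V_k = R_k T_k with M_k = T_k R_k, |T_k| = t_k < q_k (R_k non-empty), and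
-- the first q_k - 1 letters of V_k are those of s.
IsVData : (ℕ → ℕ) → (ℕ → ℕ) → (ℕ → ℕ) → Set
IsVData a s t = (t 0 ≡ 0) × (∀ k → (t (suc k) ℕ.< q a (suc k))
  × (take (q a (suc k) ∸ 1) (rot (t (suc k)) (M a (suc k))) ≡ pref s (q a (suc k) ∸ 1)))

V : (ℕ → ℕ) → (ℕ → ℕ) → ℕ → Word
V a t zero = 0 ∷ []
V a t (suc k) = rot (t (suc k)) (M a (suc k))

-- formal intercept b_k (k ≥ 1), as a rational; b 0 is unused (set to 0)
b : (ℕ → ℕ) → (ℕ → ℕ) → ℕ → ℚᵘ
b a t zero = 0ℚᵘ
b a t (suc zero) = ℕ→ℚ (t 1)
b a t (suc (suc k)) = frac (+ t (suc (suc k)) ℤ.- + t (suc k)) (q a (suc k) ∸ 1)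

lcp : Word → Word → Word
lcp [] v = []
lcp (x ∷ u) [] = []
lcp (x ∷ u) (y ∷ v) with x ℕ.≟ y
... | yes _ = x ∷ lcp u v
... | no _ = []

W : (ℕ → ℕ) → (ℕ → ℕ) → ℕ → Word
W a t k = lcp (V a t (suc k) ++ V a t k) (V a t k ++ V a t (suc k))

sum1 : (ℕ → ℚᵘ) → ℕ → ℚᵘ
sum1 f zero = 0ℚᵘ
sum1 f (suc k) = sum1 f k Q.+ f (suc k)

module Submission where

-- M_(k+1) M_k and M_k M_(k+1) differ exactly in their last two letters; their common
-- prefix P_k (central k below) satisfies P_0 = 0^(a_1 - 1) and P_(k+1) = M_(k+1)^(a_(k+2)) P_k.
-- Conjugating by T_(k+1) carries this pair to V_(k+1) V_k and V_k V_(k+1), provided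
-- T_(k+1) = M_k^(b_(k+1)) T_k with b_(k+1) ≤ a_(k+1); then P_k = T_(k+1) W_k, and cancelling
-- the T's in the recursion for P gives the recursion for W.  The factorisation of T_(k+1),
-- i.e. t_(k+1) ≡ t_k (mod q_k), holds because rotating M_(k+1) by c q_k + v agrees with
-- rotating M_k by v on q_k - 1 letters, V_(k+1) and V_k both start with the same q_k - 1
-- letters of s, and a rotation of M_k is determined by those letters: M_k is primitive
-- (gcd (p_k, q_k) = 1, p_k being its number of 1s), so its rotations are distinct and all
-- have the same letter sum.

open import Defs
open import Function using (_∘_)
open import Data.Empty using (⊥; ⊥-elim)
open import Data.Product using (∃; ∃₂; _×_; _,_; proj₁; proj₂)
open import Data.Sum using (_⊎_; inj₁; inj₂)
open import Data.Nat using (ℕ; zero; suc; _≤_; _<_; _+_; _*_; _∸_; _⊓_; z≤n; s≤s; s≤s⁻¹; _≟_)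
open import Data.Nat.Properties
open import Data.Nat.Divisibility using (_∣_; divides; ∣m+n∣m⇒∣n; ∣1⇒≡1; ∣m⇒∣m*n; ∣n⇒∣m*n)
open import Data.Nat.Coprimality using (Coprime)
open import Data.Nat.DivMod using (_/_; _%_; m≡m%n+[m/n]*n; m%n<n)
open import Data.Nat.ListAction using (sum)
open import Data.Nat.ListAction.Properties using (sum-++; sum-↭)
open import Data.Integer as ℤ using (+_)
import Data.Integer.Properties as ℤP
open import Data.Integer.Tactic.RingSolver using (solve-∀)
open import Data.Rational.Unnormalised as Q using (ℚᵘ; _≃_; *≡*)
import Data.Rational.Unnormalised.Properties as QP
open import Data.List using (List; []; _∷_; _++_; replicate; length; take; drop; applyUpTo)
open import Data.List.Properties
  using (++-assoc; ++-identityʳ; ++-cancelˡ; ∷-injective; ∷-injectiveʳ; length-++; length-take;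
         length-drop; length-replicate; take-[]; take-take; take++drop≡id; drop-drop)
open import Data.List.Relation.Binary.Permutation.Propositional using (_↭_; ↭-trans; ↭-reflexive)
open import Data.List.Relation.Binary.Permutation.Propositional.Properties
  using (↭-length) renaming (++-comm to ↭-++-comm)
open import Relation.Nullary using (yes; no)
open import Relation.Binary.Definitions using (Tri; tri<; tri≈; tri>)
open import Relation.Binary.PropositionalEquality
open ≡-Reasoning

m∸[n∸o]≤o : ∀ {m n o} → m ≤ n → o ≤ n → m ∸ (n ∸ o) ≤ o
m∸[n∸o]≤o {n = n} {o} m≤n o≤n = ≤-trans (∸-monoˡ-≤ (n ∸ o) m≤n) (≤-reflexive (m∸[m∸n]≡n o≤n))

x*[y*z]≡y*x*z : ∀ x y z → x * (y * z) ≡ y * x * z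
x*[y*z]≡y*x*z x y z = trans (sym (*-assoc x y z)) (cong (_* z) (*-comm x y))

euclidean-division : ∀ u n → 0 < n → ∃₂ λ c v → (u ≡ c * n + v) × (v < n)
euclidean-division u (suc n) _ = u / suc n , u % suc n ,
  trans (m≡m%n+[m/n]*n u (suc n)) (+-comm (u % suc n) _) , m%n<n u (suc n)

private variable
  A : Set

take-++-≤ : ∀ n (xs ys : List A) → n ≤ length xs → take n (xs ++ ys) ≡ take n xs
take-++-≤ zero    xs       ys _         = refl
take-++-≤ (suc n) (x ∷ xs) ys (s≤s n≤) = cong (x ∷_) (take-++-≤ n xs ys n≤)

take-++-≥ : ∀ n (xs ys : List A) → length xs ≤ n →
            take n (xs ++ ys) ≡ xs ++ take (n ∸ length xs) ys
take-++-≥ n       []       ys _         = refl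
take-++-≥ (suc n) (x ∷ xs) ys (s≤s ≤n) = cong (x ∷_) (take-++-≥ n xs ys ≤n)

drop-++-≤ : ∀ n (xs ys : List A) → n ≤ length xs → drop n (xs ++ ys) ≡ drop n xs ++ ys
drop-++-≤ zero    xs       ys _         = refl
drop-++-≤ (suc n) (x ∷ xs) ys (s≤s n≤) = drop-++-≤ n xs ys n≤

drop-length-++ : ∀ (xs ys : List A) → drop (length xs) (xs ++ ys) ≡ ys
drop-length-++ []       ys = refl
drop-length-++ (x ∷ xs) ys = drop-length-++ xs ys

take-length-++ : ∀ (xs ys : List A) → take (length xs) (xs ++ ys) ≡ xs
take-length-++ []       ys = refl
take-length-++ (x ∷ xs) ys = cong (x ∷_) (take-length-++ xs ys)

take-+ : ∀ m n (xs : List A) → take (m + n) xs ≡ take m xs ++ take n (drop m xs)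
take-+ zero    n xs       = refl
take-+ (suc m) n []       = sym (take-[] n)
take-+ (suc m) n (x ∷ xs) = cong (x ∷_) (take-+ m n xs)

take-applyUpTo : ∀ (f : ℕ → A) {m n} → m ≤ n → take m (applyUpTo f n) ≡ applyUpTo f m
take-applyUpTo f {zero}  _         = refl
take-applyUpTo f {suc m} (s≤s m≤n) = cong (f 0 ∷_) (take-applyUpTo (f ∘ suc) m≤n)

take-replicate : ∀ {m n} (x : A) → m ≤ n → take m (replicate n x) ≡ replicate m x
take-replicate {m = zero}  x _         = refl
take-replicate {m = suc m} x (s≤s m≤n) = cong (x ∷_) (take-replicate x m≤n)

length-take-≤ : ∀ n (xs : List A) → n ≤ length xs → length (take n xs) ≡ n
length-take-≤ n xs n≤ = trans (length-take n xs) (m≤n⇒m⊓n≡m n≤)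

++-cancel-length : ∀ (xs ys xs′ ys′ : List A) → xs ++ ys ≡ xs′ ++ ys′ →
                   length xs ≡ length xs′ → ys ≡ ys′
++-cancel-length []       ys []         ys′ eq _   = eq
++-cancel-length (x ∷ xs) ys (x′ ∷ xs′) ys′ eq len =
  ++-cancel-length xs ys xs′ ys′ (∷-injectiveʳ eq) (suc-injective len)

infix 4 _≈[_]_

_≈[_]_ : List A → ℕ → List A → Set
xs ≈[ j ] ys = take j xs ≡ take j ys

≈-weaken : ∀ {i j} (xs ys : List A) → i ≤ j → xs ≈[ j ] ys → xs ≈[ i ] ys
≈-weaken {i = i} {j} xs ys i≤j eq = begin
  take i xs           ≡⟨ cong (λ n → take n xs) (m≤n⇒m⊓n≡m i≤j) ⟨
  take (i ⊓ j) xs     ≡⟨ take-take i j xs ⟨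
  take i (take j xs)  ≡⟨ cong (take i) eq ⟩
  take i (take j ys)  ≡⟨ take-take i j ys ⟩
  take (i ⊓ j) ys     ≡⟨ cong (λ n → take n ys) (m≤n⇒m⊓n≡m i≤j) ⟩
  take i ys           ∎

≈-take : ∀ {j} n (xs : List A) → j ≤ n → take n xs ≈[ j ] xs
≈-take {j = j} n xs j≤n = trans (take-take j n xs) (cong (λ i → take i xs) (m≤n⇒m⊓n≡m j≤n))

≈-++ : ∀ j (zs xs ys : List A) → xs ≈[ j ∸ length zs ] ys → zs ++ xs ≈[ j ] zs ++ ys
≈-++ j       []       xs ys eq = eq
≈-++ zero    (z ∷ zs) xs ys eq = refl
≈-++ (suc j) (z ∷ zs) xs ys eq = cong (z ∷_) (≈-++ j zs xs ys eq)

≈-common-prefix : ∀ {j} (zs xs ys : List A) → j ≤ length zs → zs ++ xs ≈[ j ] zs ++ ys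
≈-common-prefix {j = j} zs xs ys j≤ =
  ≈-++ j zs xs ys (subst (λ i → xs ≈[ i ] ys) (sym (m≤n⇒m∸n≡0 j≤)) refl)

≈-drop : ∀ i {j} (xs ys : List A) → xs ≈[ i + j ] ys → drop i xs ≈[ j ] drop i ys
≈-drop zero    xs       ys       eq = eq
≈-drop (suc i) []       []       eq = refl
≈-drop (suc i) (x ∷ xs) (y ∷ ys) eq = ≈-drop i xs ys (∷-injectiveʳ eq)

≡-by-prefix-sum : ∀ n (xs ys : Word) → length xs ≡ suc n → length ys ≡ suc n →
                  xs ≈[ n ] ys → sum xs ≡ sum ys → xs ≡ ys
≡-by-prefix-sum zero    (x ∷ [])  (y ∷ [])  _  _  _     Σ≡ = cong (_∷ []) (+-cancelʳ-≡ 0 x y Σ≡)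
≡-by-prefix-sum (suc n) (x ∷ xs) (y ∷ ys) lx ly prefix Σ≡ with ∷-injective prefix
... | refl , prefix′ = cong (x ∷_)
  (≡-by-prefix-sum n xs ys (suc-injective lx) (suc-injective ly) prefix′ (+-cancelˡ-≡ x _ _ Σ≡))

lcp-++ : ∀ (w u v : Word) → lcp (w ++ u) (w ++ v) ≡ w ++ lcp u v
lcp-++ []      u v = refl
lcp-++ (x ∷ w) u v with x ≟ x
... | yes _  = cong (x ∷_) (lcp-++ w u v)
... | no x≢x = ⊥-elim (x≢x refl)

lcp-mismatch : ∀ (w u v : Word) {x y} → x ≢ y → lcp (w ++ x ∷ u) (w ++ y ∷ v) ≡ w
lcp-mismatch w u v {x} {y} x≢y = trans (lcp-++ w (x ∷ u) (y ∷ v)) (trans (cong (w ++_) mismatch) (++-identityʳ w))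
  where
  mismatch : lcp (x ∷ u) (y ∷ v) ≡ []
  mismatch with x ≟ y
  ... | yes x≡y = ⊥-elim (x≢y x≡y)
  ... | no _    = refl

rot-↭ : ∀ t (xs : Word) → rot t xs ↭ xs
rot-↭ t xs = ↭-trans (↭-++-comm (drop t xs) (take t xs)) (↭-reflexive (take++drop≡id t xs))

length-rot : ∀ t (xs : Word) → length (rot t xs) ≡ length xs
length-rot t xs = ↭-length (rot-↭ t xs)

sum-rot : ∀ t (xs : Word) → sum (rot t xs) ≡ sum xs
sum-rot t xs = sum-↭ (rot-↭ t xs)

rot-rot : ∀ {v w} (xs : Word) → v ≤ w → w ≤ length xs → rot (w ∸ v) (rot v xs) ≡ rot w xs
rot-rot {v} {w} xs v≤w w≤ = begin
  drop d (D ++ take v xs) ++ take d (D ++ take v xs)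
    ≡⟨ cong₂ _++_ (drop-++-≤ d D _ d≤) (take-++-≤ d D _ d≤) ⟩
  (drop d D ++ take v xs) ++ take d D                 ≡⟨ ++-assoc (drop d D) _ _ ⟩
  drop d D ++ (take v xs ++ take d D)                 ≡⟨ cong₂ _++_ (sym (drop-drop v d xs)) (take-+ v d xs) ⟨
  drop (v + d) xs ++ take (v + d) xs                  ≡⟨ cong (λ n → rot n xs) (m+[n∸m]≡n v≤w) ⟩
  rot w xs                                            ∎
  where
  d = w ∸ v
  D = drop v xs
  d≤ : d ≤ length D
  d≤ = subst (d ≤_) (sym (length-drop v xs)) (∸-monoˡ-≤ v w≤)

^^-+ : ∀ (w : Word) m n → w ^^ (m + n) ≡ (w ^^ m) ++ (w ^^ n)
^^-+ w zero    n = refl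
^^-+ w (suc m) n = trans (cong (w ++_) (^^-+ w m n)) (sym (++-assoc w (w ^^ m) (w ^^ n)))

^^-comm : ∀ (w : Word) n → w ++ (w ^^ n) ≡ (w ^^ n) ++ w
^^-comm w zero    = ++-identityʳ w
^^-comm w (suc n) = begin
  w ++ (w ++ (w ^^ n))  ≡⟨ cong (w ++_) (^^-comm w n) ⟩
  w ++ ((w ^^ n) ++ w)  ≡⟨ ++-assoc w (w ^^ n) w ⟨
  (w ++ (w ^^ n)) ++ w  ∎

length-^^ : ∀ (w : Word) n → length (w ^^ n) ≡ n * length w
length-^^ w zero    = refl
length-^^ w (suc n) = trans (length-++ w) (cong (_+_ (length w)) (length-^^ w n))

sum-^^ : ∀ (w : Word) n → sum (w ^^ n) ≡ n * sum w
sum-^^ w zero    = refl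
sum-^^ w (suc n) = trans (sum-++ w (w ^^ n)) (cong (_+_ (sum w)) (sum-^^ w n))

^^-conjugate : ∀ (u v : Word) n → ((u ++ v) ^^ n) ++ u ≡ u ++ ((v ++ u) ^^ n)
^^-conjugate u v zero    = sym (++-identityʳ u)
^^-conjugate u v (suc n) = begin
  ((u ++ v) ++ ((u ++ v) ^^ n)) ++ u  ≡⟨ ++-assoc (u ++ v) _ u ⟩
  (u ++ v) ++ (((u ++ v) ^^ n) ++ u)  ≡⟨ cong ((u ++ v) ++_) (^^-conjugate u v n) ⟩
  (u ++ v) ++ (u ++ ((v ++ u) ^^ n))  ≡⟨ ++-assoc u v _ ⟩
  u ++ (v ++ (u ++ ((v ++ u) ^^ n)))  ≡⟨ cong (u ++_) (++-assoc v u _) ⟨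
  u ++ ((v ++ u) ++ ((v ++ u) ^^ n))  ∎

replicate-^^ : ∀ n x → (x ∷ []) ^^ n ≡ replicate n x
replicate-^^ zero    x = refl
replicate-^^ (suc n) x = cong (x ∷_) (replicate-^^ n x)

sum-replicate-0 : ∀ n → sum (replicate n 0) ≡ 0
sum-replicate-0 zero    = refl
sum-replicate-0 (suc n) = sum-replicate-0 n

^^-take-rot : ∀ (w : Word) c v → ((w ^^ c) ++ take v w) ++ rot v w ≡ w ++ ((w ^^ c) ++ take v w)
^^-take-rot w c v = begin
  ((w ^^ c) ++ T) ++ (drop v w ++ T)  ≡⟨ ++-assoc (w ^^ c) T _ ⟩
  (w ^^ c) ++ (T ++ (drop v w ++ T))  ≡⟨ cong ((w ^^ c) ++_) (++-assoc T (drop v w) T) ⟨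
  (w ^^ c) ++ ((T ++ drop v w) ++ T)  ≡⟨ cong (λ x → (w ^^ c) ++ (x ++ T)) (take++drop≡id v w) ⟩
  (w ^^ c) ++ (w ++ T)                ≡⟨ ++-assoc (w ^^ c) w T ⟨
  ((w ^^ c) ++ w) ++ T                ≡⟨ cong (_++ T) (^^-comm w c) ⟨
  (w ++ (w ^^ c)) ++ T                ≡⟨ ++-assoc w (w ^^ c) T ⟩
  w ++ ((w ^^ c) ++ T)                ∎
  where T = take v w

-- Commuting and primitive words

CommonPower : Word → Word → Set
CommonPower u v = ∃ λ z → ∃₂ λ i j → (u ≡ z ^^ i) × (v ≡ z ^^ j)

commute-shorter : ∀ (u v : Word) → u ++ v ≡ v ++ u → length u ≤ length v →
                  ∃ λ v′ → (v ≡ u ++ v′) × (u ++ v′ ≡ v′ ++ u)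
commute-shorter u v comm u≤v = v′ , v≡uv′ , ++-cancelˡ u (u ++ v′) (v′ ++ u) (begin
    u ++ (u ++ v′)  ≡⟨ cong (u ++_) v≡uv′ ⟨
    u ++ v          ≡⟨ comm ⟩
    v ++ u          ≡⟨ cong (_++ u) v≡uv′ ⟩
    (u ++ v′) ++ u  ≡⟨ ++-assoc u v′ u ⟩
    u ++ (v′ ++ u)  ∎)
  where
  v′ = drop (length u) v
  u≡ : u ≡ take (length u) v
  u≡ = begin
    u                            ≡⟨ take-length-++ u v ⟨
    take (length u) (u ++ v)     ≡⟨ cong (take (length u)) comm ⟩
    take (length u) (v ++ u)     ≡⟨ take-++-≤ (length u) v u u≤v ⟩
    take (length u) v            ∎
  v≡uv′ : v ≡ u ++ v′
  v≡uv′ = trans (sym (take++drop≡id (length u) v)) (cong (_++ v′) (sym u≡))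

extend-common-power : ∀ (u v : Word) → CommonPower u v → CommonPower u (u ++ v)
extend-common-power u v (z , i , j , u≡ , v≡) =
  z , i , i + j , u≡ , trans (cong₂ _++_ u≡ v≡) (sym (^^-+ z i j))

swap-common-power : ∀ (u v : Word) → CommonPower u v → CommonPower v u
swap-common-power u v (z , i , j , u≡ , v≡) = z , j , i , v≡ , u≡

commute⇒common-power-≤ : ∀ n (u v : Word) → length u + length v ≤ n →
                         u ++ v ≡ v ++ u → CommonPower u v
strip-shorter : ∀ n x (u v : Word) → length (x ∷ u) + length v ≤ suc n →
                (x ∷ u) ++ v ≡ v ++ (x ∷ u) → length (x ∷ u) ≤ length v → CommonPower (x ∷ u) v

commute⇒common-power-≤ n       []      v       _     _    = v , 0 , 1 , refl , sym (++-identityʳ v)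
commute⇒common-power-≤ n       (x ∷ u) []      _     _    = x ∷ u , 1 , 0 , sym (++-identityʳ (x ∷ u)) , refl
commute⇒common-power-≤ (suc n) (x ∷ u) (y ∷ v) bound comm
  with ≤-total (length (x ∷ u)) (length (y ∷ v))
... | inj₁ u≤v = strip-shorter n x u (y ∷ v) bound comm u≤v
... | inj₂ v≤u = swap-common-power (y ∷ v) (x ∷ u)
  (strip-shorter n y v (x ∷ u) (subst (_≤ suc n) (+-comm (length (x ∷ u)) _) bound) (sym comm) v≤u)

strip-shorter n x u v bound comm u≤v with commute-shorter (x ∷ u) v comm u≤v
... | v′ , v≡ , comm′ = subst (CommonPower (x ∷ u)) (sym v≡)
  (extend-common-power (x ∷ u) v′ (commute⇒common-power-≤ n (x ∷ u) v′ bound′ comm′))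
  where
  bound′ : length (x ∷ u) + length v′ ≤ n
  bound′ = ≤-trans (m≤n+m _ (length u)) (s≤s⁻¹ (subst (λ l → length (x ∷ u) + l ≤ suc n)
             (trans (cong length v≡) (length-++ (x ∷ u))) bound))

commute⇒common-power : ∀ (u v : Word) → u ++ v ≡ v ++ u → CommonPower u v
commute⇒common-power u v = commute⇒common-power-≤ _ u v ≤-refl

Primitive : Word → Set
Primitive w = ∀ z n → w ≡ z ^^ n → n ≡ 1

-- A proper rotation fixing w splits w = u v with u v = v u, making w a proper power.
rot-≢-primitive : ∀ d (w : Word) → Primitive w → 0 < d → d < length w → rot d w ≢ w
rot-≢-primitive d w prim 0<d d<w fixed
  with commute⇒common-power (take d w) (drop d w) (trans (take++drop≡id d w) (sym fixed))
... | z , i , j , u≡ , v≡ = split i j u≡ v≡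
  where
  split : ∀ i j → take d w ≡ z ^^ i → drop d w ≡ z ^^ j → ⊥
  split zero    j       u≡ _  = <⇒≢ 0<d (sym (trans (sym (length-take-≤ d w (<⇒≤ d<w))) (cong length u≡)))
  split (suc i) zero    _  v≡ = <⇒≢ (m<n⇒0<n∸m d<w) (sym (trans (sym (length-drop d w)) (cong length v≡)))
  split (suc i) (suc j) u≡ v≡ = m+1+n≢0 i (suc-injective (prim z (suc i + suc j) (begin
    w                              ≡⟨ take++drop≡id d w ⟨
    take d w ++ drop d w           ≡⟨ cong₂ _++_ u≡ v≡ ⟩
    (z ^^ suc i) ++ (z ^^ suc j)   ≡⟨ ^^-+ z (suc i) (suc j) ⟨
    z ^^ (suc i + suc j)           ∎)))

rot-injective : ∀ {v w} (xs : Word) → Primitive (rot v xs) → v < w → w < length xs →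
                rot v xs ≢ rot w xs
rot-injective {v} {w} xs prim v<w w<xs eq =
  rot-≢-primitive (w ∸ v) (rot v xs) prim (m<n⇒0<n∸m v<w)
    (subst (w ∸ v <_) (sym (length-rot v xs)) (≤-<-trans (m∸n≤m w v) w<xs))
    (trans (rot-rot xs (<⇒≤ v<w) (<⇒≤ w<xs)) (sym eq))

-- Standard words

module StandardWords (a : ℕ → ℕ) (a≥1 : ∀ k → 1 ≤ a (suc k)) where

  a≡suc : ∀ k → a (suc k) ≡ suc (a (suc k) ∸ 1)
  a≡suc k = sym (m+[n∸m]≡n (a≥1 k))

  M-unfold : ∀ k → M a (suc (suc k)) ≡ M a (suc k) ++ ((M a (suc k) ^^ (a (suc (suc k)) ∸ 1)) ++ M a k)
  M-unfold k = begin
    (Y ^^ a (suc (suc k))) ++ M a k                       ≡⟨ cong (λ e → (Y ^^ e) ++ M a k) (a≡suc (suc k)) ⟩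
    (Y ++ (Y ^^ (a (suc (suc k)) ∸ 1))) ++ M a k          ≡⟨ ++-assoc Y _ _ ⟩
    Y ++ ((Y ^^ (a (suc (suc k)) ∸ 1)) ++ M a k)          ∎
    where Y = M a (suc k)

  length-M : ∀ k → length (M a k) ≡ q a k
  length-M zero          = refl
  length-M (suc zero)    = begin
    length (replicate (a 1 ∸ 1) 0 ++ 1 ∷ [])  ≡⟨ length-++ (replicate (a 1 ∸ 1) 0) ⟩
    length (replicate (a 1 ∸ 1) 0) + 1        ≡⟨ cong (_+ 1) (length-replicate (a 1 ∸ 1)) ⟩
    a 1 ∸ 1 + 1                               ≡⟨ m∸n+n≡m (a≥1 0) ⟩
    a 1                                       ∎
  length-M (suc (suc k)) = trans (length-++ (M a (suc k) ^^ α))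
    (cong₂ _+_ (trans (length-^^ (M a (suc k)) α) (cong (α *_) (length-M (suc k)))) (length-M k))
    where α = a (suc (suc k))

  sum-M : ∀ k → sum (M a k) ≡ p a k
  sum-M zero          = refl
  sum-M (suc zero)    = trans (sum-++ (replicate (a 1 ∸ 1) 0) (1 ∷ [])) (cong (_+ 1) (sum-replicate-0 (a 1 ∸ 1)))
  sum-M (suc (suc k)) = trans (sum-++ (M a (suc k) ^^ α) (M a k))
    (cong₂ _+_ (trans (sum-^^ (M a (suc k)) α) (cong (α *_) (sum-M (suc k)))) (sum-M k))
    where α = a (suc (suc k))

  q>0 : ∀ k → 0 < q a k
  q>0 zero          = s≤s z≤n
  q>0 (suc zero)    = a≥1 0
  q>0 (suc (suc k)) = ≤-trans (q>0 k) (m≤n+m (q a k) _)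

  q-mono : ∀ k → q a k ≤ q a (suc k)
  q-mono zero    = a≥1 0
  q-mono (suc k) = ≤-trans (≤-trans (≤-reflexive (sym (*-identityˡ (q a (suc k)))))
                                    (*-monoˡ-≤ (q a (suc k)) (a≥1 (suc k))))
                           (m≤m+n _ (q a k))

  p-q-det : ∀ k → (p a (suc k) * q a k ≡ p a k * q a (suc k) + 1)
                ⊎ (p a k * q a (suc k) ≡ p a (suc k) * q a k + 1)
  p-q-det zero    = inj₁ refl
  p-q-det (suc k) with p-q-det k
  ... | inj₁ det = inj₂ (begin
    p₁ * (α * q₁ + q₀)           ≡⟨ *-distribˡ-+ p₁ (α * q₁) q₀ ⟩
    p₁ * (α * q₁) + p₁ * q₀      ≡⟨ cong₂ _+_ (x*[y*z]≡y*x*z p₁ α q₁) det ⟩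
    α * p₁ * q₁ + (p₀ * q₁ + 1)  ≡⟨ +-assoc (α * p₁ * q₁) (p₀ * q₁) 1 ⟨
    α * p₁ * q₁ + p₀ * q₁ + 1    ≡⟨ cong (_+ 1) (*-distribʳ-+ q₁ (α * p₁) p₀) ⟨
    (α * p₁ + p₀) * q₁ + 1       ∎)
    where
    α = a (suc (suc k)); p₁ = p a (suc k); q₁ = q a (suc k); p₀ = p a k; q₀ = q a k
  ... | inj₂ det = inj₁ (begin
    (α * p₁ + p₀) * q₁           ≡⟨ *-distribʳ-+ q₁ (α * p₁) p₀ ⟩
    α * p₁ * q₁ + p₀ * q₁        ≡⟨ cong₂ _+_ (sym (x*[y*z]≡y*x*z p₁ α q₁)) det ⟩
    p₁ * (α * q₁) + (p₁ * q₀ + 1) ≡⟨ +-assoc (p₁ * (α * q₁)) (p₁ * q₀) 1 ⟨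
    p₁ * (α * q₁) + p₁ * q₀ + 1  ≡⟨ cong (_+ 1) (*-distribˡ-+ p₁ (α * q₁) q₀) ⟨
    p₁ * (α * q₁ + q₀) + 1       ∎)
    where
    α = a (suc (suc k)); p₁ = p a (suc k); q₁ = q a (suc k); p₀ = p a k; q₀ = q a k

  q-p-coprime : ∀ k → Coprime (q a k) (p a k)
  q-p-coprime k {d} (d∣q , d∣p) with p-q-det k
  ... | inj₁ det = ∣1⇒≡1 (∣m+n∣m⇒∣n (subst (d ∣_) det (∣n⇒∣m*n (p a (suc k)) d∣q))
                                    (∣m⇒∣m*n (q a (suc k)) d∣p))
  ... | inj₂ det = ∣1⇒≡1 (∣m+n∣m⇒∣n (subst (d ∣_) det (∣m⇒∣m*n (q a (suc k)) d∣p))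
                                    (∣n⇒∣m*n (p a (suc k)) d∣q))

  -- A power z ^^ n of length q_k and weight p_k forces n ∣ gcd (q_k, p_k) = 1.
  rot-M-primitive : ∀ k v → Primitive (rot v (M a k))
  rot-M-primitive k v z n w≡z^n = q-p-coprime k (divides (length z) length≡ , divides (sum z) sum≡)
    where
    length≡ : q a k ≡ length z * n
    length≡ = begin
      q a k                 ≡⟨ length-M k ⟨
      length (M a k)        ≡⟨ length-rot v (M a k) ⟨
      length (rot v (M a k)) ≡⟨ cong length w≡z^n ⟩
      length (z ^^ n)       ≡⟨ length-^^ z n ⟩
      n * length z          ≡⟨ *-comm n (length z) ⟩
      length z * n          ∎
    sum≡ : p a k ≡ sum z * n
    sum≡ = begin
      p a k                 ≡⟨ sum-M k ⟨
      sum (M a k)           ≡⟨ sum-rot v (M a k) ⟨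
      sum (rot v (M a k))   ≡⟨ cong sum w≡z^n ⟩
      sum (z ^^ n)          ≡⟨ sum-^^ z n ⟩
      n * sum z             ≡⟨ *-comm n (sum z) ⟩
      sum z * n             ∎

  rot-M-determined-by-prefix : ∀ k {v w} → v < q a k → w < q a k →
                               rot v (M a k) ≈[ q a k ∸ 1 ] rot w (M a k) → v ≡ w
  rot-M-determined-by-prefix k {v} {w} v<q w<q prefix = by-cases (<-cmp v w)
    where
    <-length : ∀ {u} → u < q a k → u < length (M a k)
    <-length = subst (_ <_) (sym (length-M k))
    length-rot-M : ∀ u → length (rot u (M a k)) ≡ suc (q a k ∸ 1)
    length-rot-M u = trans (length-rot u (M a k)) (trans (length-M k) (sym (m+[n∸m]≡n (q>0 k))))
    rot≡ : rot v (M a k) ≡ rot w (M a k)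
    rot≡ = ≡-by-prefix-sum (q a k ∸ 1) _ _ (length-rot-M v) (length-rot-M w) prefix
             (trans (sum-rot v (M a k)) (sym (sum-rot w (M a k))))
    by-cases : Tri (v < w) (v ≡ w) (w < v) → v ≡ w
    by-cases (tri≈ _ v≡w _) = v≡w
    by-cases (tri< v<w _ _) = ⊥-elim (rot-injective (M a k) (rot-M-primitive k v) v<w (<-length w<q) rot≡)
    by-cases (tri> _ _ w<v) = ⊥-elim (rot-injective (M a k) (rot-M-primitive k w) w<v (<-length v<q) (sym rot≡))

  central : ℕ → Word
  central zero    = replicate (a 1 ∸ 1) 0
  central (suc k) = (M a (suc k) ^^ a (suc (suc k))) ++ central k

  M-near-commute : ∀ k → ∃₂ λ x y → x ≢ y
    × (M a (suc k) ++ M a k ≡ central k ++ x ∷ y ∷ [])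
    × (M a k ++ M a (suc k) ≡ central k ++ y ∷ x ∷ [])
  M-near-commute zero = 1 , 0 , (λ ()) , ++-assoc (central 0) (1 ∷ []) (0 ∷ []) , (begin
    0 ∷ central 0 ++ 1 ∷ []              ≡⟨ cong (λ w → w ++ 1 ∷ []) 0∷0ⁿ≡0ⁿ∷ʳ0 ⟩
    (central 0 ++ 0 ∷ []) ++ 1 ∷ []      ≡⟨ ++-assoc (central 0) (0 ∷ []) (1 ∷ []) ⟩
    central 0 ++ 0 ∷ 1 ∷ []              ∎)
    where
    0∷0ⁿ≡0ⁿ∷ʳ0 : 0 ∷ central 0 ≡ central 0 ++ 0 ∷ []
    0∷0ⁿ≡0ⁿ∷ʳ0 = begin
      0 ∷ replicate (a 1 ∸ 1) 0                     ≡⟨ cong (0 ∷_) (replicate-^^ (a 1 ∸ 1) 0) ⟨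
      (0 ∷ []) ++ ((0 ∷ []) ^^ (a 1 ∸ 1))           ≡⟨ ^^-comm (0 ∷ []) (a 1 ∸ 1) ⟩
      ((0 ∷ []) ^^ (a 1 ∸ 1)) ++ 0 ∷ []             ≡⟨ cong (_++ 0 ∷ []) (replicate-^^ (a 1 ∸ 1) 0) ⟩
      replicate (a 1 ∸ 1) 0 ++ 0 ∷ []               ∎
  M-near-commute (suc k) with M-near-commute k
  ... | x , y , x≢y , YZ≡ , ZY≡ = y , x , x≢y ∘ sym , XY≡ , YX≡
    where
    Y  = M a (suc k)
    Z  = M a k
    Yᵅ = Y ^^ a (suc (suc k))
    XY≡ : (Yᵅ ++ Z) ++ Y ≡ (Yᵅ ++ central k) ++ y ∷ x ∷ []
    XY≡ = begin
      (Yᵅ ++ Z) ++ Y                     ≡⟨ ++-assoc Yᵅ Z Y ⟩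
      Yᵅ ++ (Z ++ Y)                     ≡⟨ cong (Yᵅ ++_) ZY≡ ⟩
      Yᵅ ++ (central k ++ y ∷ x ∷ [])    ≡⟨ ++-assoc Yᵅ (central k) _ ⟨
      (Yᵅ ++ central k) ++ y ∷ x ∷ []    ∎
    YX≡ : Y ++ (Yᵅ ++ Z) ≡ (Yᵅ ++ central k) ++ x ∷ y ∷ []
    YX≡ = begin
      Y ++ (Yᵅ ++ Z)                     ≡⟨ ++-assoc Y Yᵅ Z ⟨
      (Y ++ Yᵅ) ++ Z                     ≡⟨ cong (_++ Z) (^^-comm Y (a (suc (suc k)))) ⟩
      (Yᵅ ++ Y) ++ Z                     ≡⟨ ++-assoc Yᵅ Y Z ⟩
      Yᵅ ++ (Y ++ Z)                     ≡⟨ cong (Yᵅ ++_) YZ≡ ⟩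
      Yᵅ ++ (central k ++ x ∷ y ∷ [])    ≡⟨ ++-assoc Yᵅ (central k) _ ⟨
      (Yᵅ ++ central k) ++ x ∷ y ∷ []    ∎

  length-central : ∀ k → length (central k) + 2 ≡ q a (suc k) + q a k
  length-central k with M-near-commute k
  ... | x , y , _ , YZ≡ , _ = begin
    length (central k) + 2                  ≡⟨ length-++ (central k) ⟨
    length (central k ++ x ∷ y ∷ [])        ≡⟨ cong length YZ≡ ⟨
    length (M a (suc k) ++ M a k)           ≡⟨ length-++ (M a (suc k)) ⟩
    length (M a (suc k)) + length (M a k)   ≡⟨ cong₂ _+_ (length-M (suc k)) (length-M k) ⟩
    q a (suc k) + q a k                     ∎

  M-commute-prefix : ∀ k → M a (suc k) ++ M a k ≈[ length (central k) ] M a k ++ M a (suc k)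
  M-commute-prefix k with M-near-commute k
  ... | x , y , _ , YZ≡ , ZY≡ = subst₂ (λ u v → u ≈[ length (central k) ] v) (sym YZ≡) (sym ZY≡)
                                  (≈-common-prefix (central k) _ _ ≤-refl)

  M-agree-next : ∀ k {j} → j < q a k → M a (suc k) ≈[ j ] M a k
  M-agree-next zero    (s≤s z≤n) = refl
  M-agree-next (suc k) {j} j<q = trans (cong (take j) (M-unfold k))
    (take-++-≤ j (M a (suc k)) _ (subst (j ≤_) (sym (length-M (suc k))) (<⇒≤ j<q)))

  module Division (k u c v : ℕ) (u<q : u < q a (suc (suc k))) (u≡ : u ≡ c * q a (suc k) + v)
                  (v<q : v < q a (suc k)) where

    X = M a (suc (suc k))
    Y = M a (suc k)
    Z = M a k
    α = a (suc (suc k))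
    n = q a (suc k)
    m = n ∸ 1

    v≤|Y| : v ≤ length Y
    v≤|Y| = subst (v ≤_) (sym (length-M (suc k))) (<⇒≤ v<q)

    c*n≤u : c * n ≤ u
    c*n≤u = ≤-trans (m≤m+n (c * n) v) (≤-reflexive (sym u≡))

    c≤α : c ≤ α
    c≤α = s≤s⁻¹ (*-cancelʳ-< n c (suc α) (≤-<-trans c*n≤u (<-≤-trans u<q
            (≤-trans (+-monoʳ-≤ (α * n) (q-mono k)) (≤-reflexive (+-comm (α * n) n))))))

    c≡α⇒v<q : c ≡ α → v < q a k
    c≡α⇒v<q refl = +-cancelˡ-< (c * n) v (q a k) (subst (_< q a (suc (suc k))) u≡ u<q)

    d = α ∸ c

    X-split : X ≡ (Y ^^ c) ++ ((Y ^^ d) ++ Z)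
    X-split = begin
      (Y ^^ α) ++ Z                  ≡⟨ cong (λ e → (Y ^^ e) ++ Z) (m+[n∸m]≡n c≤α) ⟨
      (Y ^^ (c + d)) ++ Z            ≡⟨ cong (_++ Z) (^^-+ Y c d) ⟩
      ((Y ^^ c) ++ (Y ^^ d)) ++ Z    ≡⟨ ++-assoc (Y ^^ c) (Y ^^ d) Z ⟩
      (Y ^^ c) ++ ((Y ^^ d) ++ Z)    ∎

    length-Yᶜ : length (Y ^^ c) ≡ c * n
    length-Yᶜ = trans (length-^^ Y c) (cong (c *_) (length-M (suc k)))

    tail≈Y : ∀ d′ → c + d′ ≡ α → (Y ^^ d′) ++ Z ≈[ v ] Y
    tail≈Y zero     c+0≡α = sym (M-agree-next k (c≡α⇒v<q (trans (sym (+-identityʳ c)) c+0≡α)))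
    tail≈Y (suc d′) _     = trans (cong (take v) (++-assoc Y (Y ^^ d′) Z)) (take-++-≤ v Y _ v≤|Y|)

    take-X : take u X ≡ (Y ^^ c) ++ take v Y
    take-X = begin
      take u X                                          ≡⟨ cong (take u) X-split ⟩
      take u ((Y ^^ c) ++ S)
        ≡⟨ take-++-≥ u (Y ^^ c) S (subst (_≤ u) (sym length-Yᶜ) c*n≤u) ⟩
      (Y ^^ c) ++ take (u ∸ length (Y ^^ c)) S          ≡⟨ cong (λ i → (Y ^^ c) ++ take i S) u∸|Yᶜ|≡v ⟩
      (Y ^^ c) ++ take v S                              ≡⟨ cong ((Y ^^ c) ++_) (tail≈Y d (m+[n∸m]≡n c≤α)) ⟩
      (Y ^^ c) ++ take v Y                              ∎
      where
      S = (Y ^^ d) ++ Z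
      u∸|Yᶜ|≡v : u ∸ length (Y ^^ c) ≡ v
      u∸|Yᶜ|≡v = trans (cong₂ _∸_ u≡ length-Yᶜ) (m+n∸m≡n (c * n) v)

    suc-m≡n : suc m ≡ n
    suc-m≡n = trans (+-comm 1 m) (m∸n+n≡m (q>0 (suc k)))

    m≤|X| : m ≤ length X
    m≤|X| = subst (m ≤_) (sym (length-M (suc (suc k)))) (≤-trans (m∸n≤m n 1) (q-mono (suc k)))

    u≤|X| : u ≤ length X
    u≤|X| = subst (u ≤_) (sym (length-M (suc (suc k)))) (<⇒≤ u<q)

    -- X Y and Y X agree up to their last two letters, and u + m falls short of that.
    u+m≤|central| : u + m ≤ length (central (suc k))
    u+m≤|central| = +-cancelʳ-≤ 2 (u + m) _
      (subst₂ _≤_ (sym u+m+2≡) (sym (length-central (suc k))) (+-monoˡ-≤ n u<q))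
      where
      u+m+2≡ : u + m + 2 ≡ suc u + n
      u+m+2≡ = begin
        u + m + 2     ≡⟨ +-assoc u m 2 ⟩
        u + (m + 2)   ≡⟨ cong (_+_ u) (trans (+-comm m 2) (cong suc suc-m≡n)) ⟩
        u + suc n     ≡⟨ +-suc u n ⟩
        suc u + n     ∎

    drop-YX : drop u (Y ++ X) ≡ drop v Y ++ ((Y ^^ d) ++ Z)
    drop-YX = begin
      drop u (Y ++ X)                        ≡⟨ cong (drop u) (trans (cong (Y ++_) X-split) (YX-regroup S)) ⟩
      drop u ((Y ^^ c) ++ (Y ++ S))          ≡⟨ cong (λ i → drop i ((Y ^^ c) ++ (Y ++ S))) u≡ ⟩
      drop (c * n + v) ((Y ^^ c) ++ (Y ++ S)) ≡⟨ drop-drop (c * n) v _ ⟨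
      drop v (drop (c * n) ((Y ^^ c) ++ (Y ++ S)))
        ≡⟨ cong (λ i → drop v (drop i ((Y ^^ c) ++ (Y ++ S)))) length-Yᶜ ⟨
      drop v (drop (length (Y ^^ c)) ((Y ^^ c) ++ (Y ++ S)))
        ≡⟨ cong (drop v) (drop-length-++ (Y ^^ c) (Y ++ S)) ⟩
      drop v (Y ++ S)                        ≡⟨ drop-++-≤ v Y S v≤|Y| ⟩
      drop v Y ++ S                          ∎
      where
      S = (Y ^^ d) ++ Z
      YX-regroup : ∀ R → Y ++ ((Y ^^ c) ++ R) ≡ (Y ^^ c) ++ (Y ++ R)
      YX-regroup R = begin
        Y ++ ((Y ^^ c) ++ R)   ≡⟨ ++-assoc Y (Y ^^ c) R ⟨
        (Y ++ (Y ^^ c)) ++ R   ≡⟨ cong (_++ R) (^^-comm Y c) ⟩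
        ((Y ^^ c) ++ Y) ++ R   ≡⟨ ++-assoc (Y ^^ c) Y R ⟩
        (Y ^^ c) ++ (Y ++ R)   ∎

    rot-X≈rot-Y : rot u X ≈[ m ] rot v Y
    rot-X≈rot-Y = begin
      take m (rot u X)
        ≡⟨ ≈-++ m (drop u X) (take u X) Y (trans (≈-take u X j≤u) (M-agree-next (suc k) j<n)) ⟩
      take m (drop u X ++ Y)
        ≡⟨ cong (take m) (drop-++-≤ u X Y u≤|X|) ⟨
      take m (drop u (X ++ Y))
        ≡⟨ ≈-drop u (X ++ Y) (Y ++ X) (≈-weaken (X ++ Y) (Y ++ X) u+m≤|central| (M-commute-prefix (suc k))) ⟩
      take m (drop u (Y ++ X))
        ≡⟨ cong (take m) drop-YX ⟩
      take m (drop v Y ++ S)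
        ≡⟨ ≈-++ m (drop v Y) S (take v Y) (≈-weaken S (take v Y) j′≤v S≈take-v-Y) ⟩
      take m (rot v Y)
        ∎
      where
      S = (Y ^^ d) ++ Z
      j = m ∸ length (drop u X)
      j≤u : j ≤ u
      j≤u = subst (λ l → m ∸ l ≤ u) (sym (length-drop u X)) (m∸[n∸o]≤o m≤|X| u≤|X|)
      j<n : j < n
      j<n = ≤-<-trans (m∸n≤m m (length (drop u X))) (subst (m <_) suc-m≡n ≤-refl)
      j′ = m ∸ length (drop v Y)
      j′≤v : j′ ≤ v
      j′≤v = subst (λ l → m ∸ l ≤ v) (sym (length-drop v Y))
               (m∸[n∸o]≤o (subst (m ≤_) (sym (length-M (suc k))) (m∸n≤m n 1)) v≤|Y|)
      S≈take-v-Y : S ≈[ v ] take v Y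
      S≈take-v-Y = trans (tail≈Y d (m+[n∸m]≡n c≤α)) (sym (≈-take v Y ≤-refl))

ℤ→ℚ-+ : ∀ x y → ℤ→ℚ (x ℤ.+ y) ≃ ℤ→ℚ x Q.+ ℤ→ℚ y
ℤ→ℚ-+ x y = *≡* (cong (ℤ._* + 1) (sym (cong₂ ℤ._+_ (ℤP.*-identityʳ x) (ℤP.*-identityʳ y))))

ℕ→ℚ-+ : ∀ m n → ℕ→ℚ (m + n) ≃ ℕ→ℚ m Q.+ ℕ→ℚ n
ℕ→ℚ-+ m n = QP.≃-trans (QP.≃-reflexive (cong ℤ→ℚ (ℤP.pos-+ m n))) (ℤ→ℚ-+ (+ m) (+ n))

ℕ→ℚ-* : ∀ m n → ℕ→ℚ (m * n) ≃ ℕ→ℚ m Q.* ℕ→ℚ n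
ℕ→ℚ-* m n = *≡* (cong (ℤ._* + 1) (ℤP.pos-* m n))

+[m∸n]≡+m-+n : ∀ {m n} → n ≤ m → + (m ∸ n) ≡ + m ℤ.- + n
+[m∸n]≡+m-+n {m} {n} n≤m = sym (trans (ℤP.m-n≡m⊖n m n) (ℤP.⊖-≥ n≤m))

ℕ→ℚ-∸ : ∀ {m n} → n ≤ m → ℕ→ℚ (m ∸ n) ≃ ℕ→ℚ m Q.- ℕ→ℚ n
ℕ→ℚ-∸ {m} {n} n≤m =
  QP.≃-trans (QP.≃-reflexive (cong ℤ→ℚ (+[m∸n]≡+m-+n n≤m))) (ℤ→ℚ-+ (+ m) (ℤ.- + n))

frac-exact : ∀ z c n → z ≡ + c ℤ.* + suc n → frac z n ≃ ℕ→ℚ c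
frac-exact z c n z≡ = *≡* (trans (ℤP.*-identityʳ z) z≡)

x≡x+y+z-y-z : ∀ x y z → x ≡ x ℤ.+ y ℤ.+ z ℤ.- y ℤ.- z
x≡x+y+z-y-z = solve-∀

-- The words V_k and W_k

module Intercepts (a : ℕ → ℕ) (a≥1 : ∀ k → 1 ≤ a (suc k)) (s t : ℕ → ℕ) (vdata : IsVData a s t) where
  open StandardWords a a≥1

  t-zero : t 0 ≡ 0
  t-zero = proj₁ vdata

  t<q : ∀ k → t k < q a k
  t<q zero    = subst (_< 1) (sym t-zero) (s≤s z≤n)
  t<q (suc k) = proj₁ (proj₂ vdata k)

  V≡rot : ∀ k → V a t k ≡ rot (t k) (M a k)
  V≡rot zero    = cong (λ i → rot i (M a 0)) (sym t-zero)
  V≡rot (suc k) = refl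

  V-agree : ∀ k → V a t (suc (suc k)) ≈[ q a (suc k) ∸ 1 ] V a t (suc k)
  V-agree k = begin
    take m (V a t (suc (suc k)))             ≡⟨ ≈-take N (V a t (suc (suc k))) m≤N ⟨
    take m (take N (V a t (suc (suc k))))    ≡⟨ cong (take m) (proj₂ (proj₂ vdata (suc k))) ⟩
    take m (pref s N)                        ≡⟨ take-applyUpTo s m≤N ⟩
    pref s m                                 ≡⟨ proj₂ (proj₂ vdata k) ⟨
    take m (V a t (suc k))                   ∎
    where
    m = q a (suc k) ∸ 1
    N = q a (suc (suc k)) ∸ 1
    m≤N : m ≤ N
    m≤N = ∸-monoˡ-≤ 1 (q-mono (suc k))

  intercept-step : ∀ k → ∃ λ c → (c ≤ a (suc k)) × (t (suc k) ≡ c * q a k + t k)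
  intercept-step zero = t 1 , <⇒≤ (t<q 1) ,
    sym (trans (cong (_+_ (t 1 * 1)) t-zero) (trans (+-identityʳ _) (*-identityʳ (t 1))))
  intercept-step (suc k) with euclidean-division (t (suc (suc k))) (q a (suc k)) (q>0 (suc k))
  ... | c , v , t≡ , v<q = c , D.c≤α , trans t≡ (cong (_+_ (c * q a (suc k))) v≡t)
    where
    module D = Division k (t (suc (suc k))) c v (t<q (suc (suc k))) t≡ v<q
    v≡t : v ≡ t (suc k)
    v≡t = rot-M-determined-by-prefix (suc k) v<q (t<q (suc k)) (trans (sym D.rot-X≈rot-Y) (V-agree k))

  -- intercept k is the formal intercept b_(k+1), which is therefore a natural number.
  intercept : ℕ → ℕ
  intercept k = proj₁ (intercept-step k)

  intercept≤a : ∀ k → intercept k ≤ a (suc k)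
  intercept≤a k = proj₁ (proj₂ (intercept-step k))

  t-suc : ∀ k → t (suc k) ≡ intercept k * q a k + t k
  t-suc k = proj₂ (proj₂ (intercept-step k))

  T : ℕ → Word
  T k = take (t k) (M a k)

  length-T : ∀ k → length (T k) ≡ t k
  length-T k = length-take-≤ (t k) (M a k) (subst (t k ≤_) (sym (length-M k)) (<⇒≤ (t<q k)))

  t₁≤ : t 1 ≤ a 1 ∸ 1
  t₁≤ = ≤-pred (subst (suc (t 1) ≤_) (sym (m+[n∸m]≡n (a≥1 0))) (t<q 1))

  T-suc : ∀ k → T (suc k) ≡ (M a k ^^ intercept k) ++ T k
  T-suc zero = begin
    take (t 1) (replicate (a 1 ∸ 1) 0 ++ 1 ∷ [])
      ≡⟨ take-++-≤ (t 1) _ _ (subst (t 1 ≤_) (sym (length-replicate (a 1 ∸ 1))) t₁≤) ⟩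
    take (t 1) (replicate (a 1 ∸ 1) 0)             ≡⟨ take-replicate 0 t₁≤ ⟩
    replicate (t 1) 0                              ≡⟨ replicate-^^ (t 1) 0 ⟨
    (0 ∷ []) ^^ t 1                                ≡⟨ ++-identityʳ _ ⟨
    ((0 ∷ []) ^^ t 1) ++ []
      ≡⟨ cong (λ i → ((0 ∷ []) ^^ t 1) ++ take i (0 ∷ [])) t-zero ⟨
    ((0 ∷ []) ^^ t 1) ++ T 0                       ∎
  T-suc (suc k) = Division.take-X k (t (suc (suc k))) (intercept (suc k)) (t (suc k))
                    (t<q (suc (suc k))) (t-suc (suc k)) (t<q (suc k))

  T-conjugates : ∀ k → T (suc k) ++ V a t k ≡ M a k ++ T (suc k)
  T-conjugates k = begin
    T (suc k) ++ V a t k                                    ≡⟨ cong₂ _++_ (T-suc k) (V≡rot k) ⟩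
    ((M a k ^^ intercept k) ++ T k) ++ rot (t k) (M a k)    ≡⟨ ^^-take-rot (M a k) (intercept k) (t k) ⟩
    M a k ++ ((M a k ^^ intercept k) ++ T k)                ≡⟨ cong (M a k ++_) (T-suc k) ⟨
    M a k ++ T (suc k)                                      ∎

  -- Moving T_(k+1) across turns M_(k+1) M_k and M_k M_(k+1) into V_(k+1) V_k and V_k V_(k+1).
  central≡T++W : ∀ k → central k ≡ T (suc k) ++ W a t k
  central≡T++W k with M-near-commute k
  ... | x , y , x≢y , XY≡ , YX≡ = sym (begin
    Tₓ ++ W a t k                                 ≡⟨ lcp-++ Tₓ (Vₓ ++ V a t k) (V a t k ++ Vₓ) ⟨
    lcp (Tₓ ++ (Vₓ ++ V a t k)) (Tₓ ++ (V a t k ++ Vₓ))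
      ≡⟨ cong₂ lcp (shift-XY) (shift-YX) ⟨
    lcp ((X ++ Y) ++ Tₓ) ((Y ++ X) ++ Tₓ)
      ≡⟨ cong₂ lcp (trans (cong (_++ Tₓ) XY≡) (++-assoc (central k) _ Tₓ))
                   (trans (cong (_++ Tₓ) YX≡) (++-assoc (central k) _ Tₓ)) ⟩
    lcp (central k ++ x ∷ y ∷ Tₓ) (central k ++ y ∷ x ∷ Tₓ)   ≡⟨ lcp-mismatch (central k) _ _ x≢y ⟩
    central k                                     ∎)
    where
    X  = M a (suc k)
    Y  = M a k
    Tₓ = T (suc k)
    R  = drop (t (suc k)) X
    Vₓ = R ++ Tₓ
    X≡ : X ≡ Tₓ ++ R
    X≡ = sym (take++drop≡id (t (suc k)) X)
    shift-XY : (X ++ Y) ++ Tₓ ≡ Tₓ ++ (Vₓ ++ V a t k)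
    shift-XY = begin
      (X ++ Y) ++ Tₓ              ≡⟨ cong (λ w → (w ++ Y) ++ Tₓ) X≡ ⟩
      ((Tₓ ++ R) ++ Y) ++ Tₓ      ≡⟨ ++-assoc (Tₓ ++ R) Y Tₓ ⟩
      (Tₓ ++ R) ++ (Y ++ Tₓ)      ≡⟨ ++-assoc Tₓ R (Y ++ Tₓ) ⟩
      Tₓ ++ (R ++ (Y ++ Tₓ))      ≡⟨ cong (λ w → Tₓ ++ (R ++ w)) (T-conjugates k) ⟨
      Tₓ ++ (R ++ (Tₓ ++ V a t k)) ≡⟨ cong (Tₓ ++_) (++-assoc R Tₓ (V a t k)) ⟨
      Tₓ ++ (Vₓ ++ V a t k)       ∎
    shift-YX : (Y ++ X) ++ Tₓ ≡ Tₓ ++ (V a t k ++ Vₓ)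
    shift-YX = begin
      (Y ++ X) ++ Tₓ              ≡⟨ ++-assoc Y X Tₓ ⟩
      Y ++ (X ++ Tₓ)              ≡⟨ cong (λ w → Y ++ (w ++ Tₓ)) X≡ ⟩
      Y ++ ((Tₓ ++ R) ++ Tₓ)      ≡⟨ cong (Y ++_) (++-assoc Tₓ R Tₓ) ⟩
      Y ++ (Tₓ ++ Vₓ)             ≡⟨ ++-assoc Y Tₓ Vₓ ⟨
      (Y ++ Tₓ) ++ Vₓ             ≡⟨ cong (_++ Vₓ) (T-conjugates k) ⟨
      (Tₓ ++ V a t k) ++ Vₓ       ≡⟨ ++-assoc Tₓ (V a t k) Vₓ ⟩
      Tₓ ++ (V a t k ++ Vₓ)       ∎

  length-W : ∀ k → length (W a t k) + t (suc k) + 2 ≡ q a (suc k) + q a k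
  length-W k = begin
    length (W a t k) + t (suc k) + 2               ≡⟨ cong (λ i → i + 2) (+-comm (length (W a t k)) (t (suc k))) ⟩
    t (suc k) + length (W a t k) + 2               ≡⟨ cong (λ i → i + length (W a t k) + 2) (length-T (suc k)) ⟨
    length (T (suc k)) + length (W a t k) + 2      ≡⟨ cong (_+ 2) (length-++ (T (suc k))) ⟨
    length (T (suc k) ++ W a t k) + 2              ≡⟨ cong (λ w → length w + 2) (central≡T++W k) ⟨
    length (central k) + 2                         ≡⟨ length-central k ⟩
    q a (suc k) + q a k                            ∎

  W-zero : W a t 0 ≡ replicate (a 1 ∸ 1 ∸ t 1) 0
  W-zero = ++-cancel-length (T 1) (W a t 0) (replicate (t 1) 0) (replicate e 0) (begin
    T 1 ++ W a t 0                         ≡⟨ central≡T++W 0 ⟨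
    replicate (a 1 ∸ 1) 0                  ≡⟨ cong (λ i → replicate i 0) (m+[n∸m]≡n t₁≤) ⟨
    replicate (t 1 + e) 0                  ≡⟨ replicate-^^ (t 1 + e) 0 ⟨
    (0 ∷ []) ^^ (t 1 + e)                  ≡⟨ ^^-+ (0 ∷ []) (t 1) e ⟩
    ((0 ∷ []) ^^ t 1) ++ ((0 ∷ []) ^^ e)   ≡⟨ cong₂ _++_ (replicate-^^ (t 1) 0) (replicate-^^ e 0) ⟩
    replicate (t 1) 0 ++ replicate e 0     ∎)
    (trans (length-T 1) (sym (length-replicate (t 1))))
    where e = a 1 ∸ 1 ∸ t 1

  exponent : ℕ → ℕ
  exponent k = a (suc (suc k)) ∸ intercept (suc k)

  W-suc : ∀ k → W a t (suc k) ≡ (V a t (suc k) ^^ exponent k) ++ W a t k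
  W-suc k = ++-cancelˡ T₂ (W a t (suc k)) ((Vₓ ^^ e) ++ W a t k) (begin
    T₂ ++ W a t (suc k)                         ≡⟨ central≡T++W (suc k) ⟨
    (X ^^ α) ++ central k                       ≡⟨ cong₂ _++_ X^α≡ (central≡T++W k) ⟩
    ((X ^^ c) ++ (X ^^ e)) ++ (Tₓ ++ W a t k)   ≡⟨ ++-assoc (X ^^ c) (X ^^ e) _ ⟩
    (X ^^ c) ++ ((X ^^ e) ++ (Tₓ ++ W a t k))   ≡⟨ cong ((X ^^ c) ++_) (++-assoc (X ^^ e) Tₓ _) ⟨
    (X ^^ c) ++ (((X ^^ e) ++ Tₓ) ++ W a t k)   ≡⟨ cong (λ w → (X ^^ c) ++ (w ++ W a t k)) Xᵉ++T≡ ⟩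
    (X ^^ c) ++ ((Tₓ ++ (Vₓ ^^ e)) ++ W a t k)  ≡⟨ cong ((X ^^ c) ++_) (++-assoc Tₓ (Vₓ ^^ e) _) ⟩
    (X ^^ c) ++ (Tₓ ++ ((Vₓ ^^ e) ++ W a t k))  ≡⟨ ++-assoc (X ^^ c) Tₓ _ ⟨
    ((X ^^ c) ++ Tₓ) ++ ((Vₓ ^^ e) ++ W a t k)  ≡⟨ cong (_++ ((Vₓ ^^ e) ++ W a t k)) (T-suc (suc k)) ⟨
    T₂ ++ ((Vₓ ^^ e) ++ W a t k)                ∎)
    where
    X  = M a (suc k)
    α  = a (suc (suc k))
    c  = intercept (suc k)
    e  = exponent k
    T₂ = T (suc (suc k))
    Tₓ = T (suc k)
    Vₓ = V a t (suc k)
    X^α≡ : X ^^ α ≡ (X ^^ c) ++ (X ^^ e)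
    X^α≡ = trans (cong (X ^^_) (sym (m+[n∸m]≡n (intercept≤a (suc k))))) (^^-+ X c e)
    Xᵉ++T≡ : (X ^^ e) ++ Tₓ ≡ Tₓ ++ (Vₓ ^^ e)
    Xᵉ++T≡ = trans (cong (λ w → (w ^^ e) ++ Tₓ) (sym (take++drop≡id (t (suc k)) X)))
                   (^^-conjugate Tₓ (drop (t (suc k)) X) e)

  length-W-suc : ∀ k → length (W a t (suc k)) ≡ exponent k * q a (suc k) + length (W a t k)
  length-W-suc k = begin
    length (W a t (suc k))                          ≡⟨ cong length (W-suc k) ⟩
    length ((Vₓ ^^ e) ++ W a t k)                   ≡⟨ length-++ (Vₓ ^^ e) ⟩
    length (Vₓ ^^ e) + length (W a t k)             ≡⟨ cong (_+ length (W a t k)) (length-^^ Vₓ e) ⟩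
    e * length Vₓ + length (W a t k)                ≡⟨ cong (λ l → e * l + length (W a t k)) length-Vₓ ⟩
    e * q a (suc k) + length (W a t k)              ∎
    where
    Vₓ = V a t (suc k)
    e  = exponent k
    length-Vₓ : length Vₓ ≡ q a (suc k)
    length-Vₓ = trans (length-rot (t (suc k)) (M a (suc k))) (length-M (suc k))

  b≃intercept : ∀ k → b a t (suc (suc k)) ≃ ℕ→ℚ (intercept (suc k))
  b≃intercept k = frac-exact _ c (n ∸ 1) (begin
    + t (suc (suc k)) ℤ.- + t (suc k)
      ≡⟨ +[m∸n]≡+m-+n (subst (t (suc k) ≤_) (sym (t-suc (suc k))) (m≤n+m _ _)) ⟨
    + (t (suc (suc k)) ∸ t (suc k))     ≡⟨ cong (λ i → + (i ∸ t (suc k))) (t-suc (suc k)) ⟩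
    + (c * n + t (suc k) ∸ t (suc k))   ≡⟨ cong +_ (m+n∸n≡m (c * n) (t (suc k))) ⟩
    + (c * n)                           ≡⟨ ℤP.pos-* c n ⟩
    + c ℤ.* + n                         ≡⟨ cong (λ i → + c ℤ.* + i) (m+[n∸m]≡n (q>0 (suc k))) ⟨
    + c ℤ.* + suc (n ∸ 1)               ∎)
    where
    c = intercept (suc k)
    n = q a (suc k)

  first-exponent≃ : ℕ→ℚ (a 1 ∸ 1 ∸ t 1) ≃ ℕ→ℚ (a 1) Q.- ℕ→ℚ 1 Q.- b a t 1
  first-exponent≃ = QP.≃-trans (ℕ→ℚ-∸ t₁≤) (QP.+-congˡ (Q.- ℕ→ℚ (t 1)) (ℕ→ℚ-∸ (a≥1 0)))

  exponent≃ : ∀ k → ℕ→ℚ (exponent k) ≃ ℕ→ℚ (a (suc (suc k))) Q.- b a t (suc (suc k))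
  exponent≃ k = QP.≃-trans (ℕ→ℚ-∸ (intercept≤a (suc k)))
    (QP.+-congʳ (ℕ→ℚ (a (suc (suc k)))) (QP.-‿cong (QP.≃-sym (b≃intercept k))))

  w₀ : ℚᵘ
  w₀ = ℕ→ℚ (a 1) Q.- ℕ→ℚ 1 Q.- b a t 1

  increment : ℕ → ℚᵘ
  increment j = (ℕ→ℚ (a (suc j)) Q.- b a t (suc j)) Q.* ℕ→ℚ (q a j)

  length-W≃ : ∀ k → ℕ→ℚ (length (W a t k)) ≃ w₀ Q.+ sum1 increment k
  length-W≃ zero = QP.≃-trans (QP.≃-reflexive (cong ℕ→ℚ (trans (cong length W-zero) (length-replicate _))))
    (QP.≃-trans first-exponent≃ (QP.≃-sym (QP.+-identityʳ w₀)))
  length-W≃ (suc k) = QP.≃-trans (QP.≃-reflexive (cong ℕ→ℚ (length-W-suc k)))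
    (QP.≃-trans (ℕ→ℚ-+ (exponent k * q a (suc k)) (length (W a t k)))
    (QP.≃-trans (QP.+-cong (QP.≃-trans (ℕ→ℚ-* (exponent k) (q a (suc k))) (QP.*-congʳ (exponent≃ k)))
                           (length-W≃ k))
    (QP.≃-trans (QP.+-comm (increment (suc k)) (w₀ Q.+ sum1 increment k))
                (QP.+-assoc w₀ (sum1 increment k) (increment (suc k))))))

  length-W-ℤ : ∀ k → + length (W a t k) ≡ + q a (suc k) ℤ.+ + q a k ℤ.- + t (suc k) ℤ.- + 2
  length-W-ℤ k = trans (x≡x+y+z-y-z (+ w) (+ t (suc k)) (+ 2))
    (cong (λ z → z ℤ.- + t (suc k) ℤ.- + 2) (begin
      + w ℤ.+ + t (suc k) ℤ.+ + 2     ≡⟨ cong (ℤ._+ + 2) (ℤP.pos-+ w (t (suc k))) ⟨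
      + (w + t (suc k)) ℤ.+ + 2       ≡⟨ ℤP.pos-+ (w + t (suc k)) 2 ⟨
      + (w + t (suc k) + 2)           ≡⟨ cong +_ (length-W k) ⟩
      + (q a (suc k) + q a k)         ≡⟨ ℤP.pos-+ (q a (suc k)) (q a k) ⟩
      + q a (suc k) ℤ.+ + q a k       ∎))
    where w = length (W a t k)

-- The slope θ and the Sturmian word enter only through IsVData.
lemma5p3 : (a : ℕ → ℕ) → (∀ k → 1 ≤ a (suc k)) → (θ : ℝ) → HasCF θ a →
    (s : ℕ → ℕ) → Sturmian θ s → (t : ℕ → ℕ) → IsVData a s t →
    (∃ λ e → (ℕ→ℚ e ≃ ℕ→ℚ (a 1) Q.- ℕ→ℚ 1 Q.- b a t 1) × (W a t 0 ≡ replicate e 0))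
    × (∀ k → ∃ λ e → (ℕ→ℚ e ≃ ℕ→ℚ (a (suc (suc k))) Q.- b a t (suc (suc k)))
         × (W a t (suc k) ≡ (V a t (suc k) ^^ e) ++ W a t k))
    × (∀ k → (ℕ→ℚ (length (W a t k))
                ≃ (ℕ→ℚ (a 1) Q.- ℕ→ℚ 1 Q.- b a t 1)
                  Q.+ sum1 (λ j → (ℕ→ℚ (a (suc j)) Q.- b a t (suc j)) Q.* ℕ→ℚ (q a j)) k)
         × (+ length (W a t k) ≡ + q a (suc k) ℤ.+ + q a k ℤ.- + t (suc k) ℤ.- + 2))
lemma5p3 a a≥1 _ _ s _ t vdata =
    (a 1 ∸ 1 ∸ t 1 , first-exponent≃ , W-zero)
  , (λ k → exponent k , exponent≃ k , W-suc k)
  , (λ k → length-W≃ k , length-W-ℤ k)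
  where open Intercepts a a≥1 s t vdata
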